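{- Let $m>1$ be an integer and let $C_m$ be the category defined as in the context. For every morphism $f=(a,\overline{x},i,j)$ of $C_m$, the Lawvere interval $I(f)$ has only finitely many objects; that is, $f$ has only finitely many factorizations $f=u\circ v$ in $C_m$.
   Context: Let $m>1$ be an integer, $\mathbb{Z}_m$ the cyclic group of integers modulo $m$ (residue class of an integer $n$ written $\overline{n}$), $\mathbb{Z}_-$ the set of non-positive integers and $\mathbb{Z}_+$ the set of non-negative integers. The category $C_m$ has object set $\mathbb{Z}_m\times\mathbb{Z}_-$; for objects $(\overline{x},i),(\overline{y},j)$, $\mathrm{Hom}_{C_m}((\overline{x},i),(\overline{y},j))=\{(a,\overline{x},i,j)\mid a\in\mathbb{Z}_+,\ a\le i-j,\ \overline{a}+\overline{x}=\overline{y}\}$; composition of $(a,\overline{x},i,j):(\overline{x},i)\to(\overline{y},j)$ and $(b,\overline{y},j,k):(\overline{y},j)\to(\overline{z},k)$ is $(b,\overline{y},j,k)\circ(a,\overline{x},i,j)=(a+b,\overline{x},i,k)$ (identities are $(0,\overline{x},i,i)$). For a morphism $f:X\to Y$ of a small category $C$, the Lawvere interval $I(f)$ is the category whose objects are the factorizations $f=u\circ v$ in $C$ (pairs $(v,u)$ of composable morphisms with $u\circ v=f$), and a morphism from $(v,u)$ to $(v',u')$ is a morphism $h$ of $C$ from the codomain of $v$ to the codomain of $v'$ with $h\circ v=v'$ and $u'\circ h=u$; composition is that of $C$. -}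

module Defs where

open import Data.Nat as ℕ using (ℕ; NonZero; _%_)
open import Data.Nat.DivMod using (_mod_; %-distribˡ-+; m%n%n≡m%n)
import Data.Nat.Properties as ℕP
open import Data.Fin using (Fin; toℕ)
open import Data.Fin.Properties using (toℕ-fromℕ<; toℕ-injective)
open import Data.Integer as ℤ using (ℤ; +_; _-_; _≤_; 0ℤ)
import Data.Integer.Properties as ℤP
open import Data.Product using (Σ; _×_; _,_)
open import Function.Bundles using (_↠_)
open import Relation.Binary.PropositionalEquality

Finite : Set → Set
Finite A = Σ ℕ λ n → Fin n ↠ A

module _ (m : ℕ) .{{_ : NonZero m}} where

  -- ℤ_m is represented by Fin m; the residue class of n ∈ ℕ is n mod m.
  ℤ/ : Set
  ℤ/ = Fin m

  record Obj : Set where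
    constructor obj
    field
      res   : ℤ/
      lvl   : ℤ
      lvl≤0 : lvl ≤ 0ℤ
  open Obj public

  -- Hom((x,i),(y,j)) = { (a,x,i,j) | a ∈ ℤ_+ , a ≤ i - j , ā + x̄ = ȳ }.
  -- The components x, i, j are determined by the source and target objects,
  -- so a morphism is recorded by a together with the two side conditions.
  record Hom (X Y : Obj) : Set where
    constructor hom
    field
      amt   : ℕ
      bound : + amt ≤ lvl X - lvl Y
      resEq : (amt ℕ.+ toℕ (res X)) mod m ≡ res Y
  open Hom public

  private
    mod-lemma : ∀ a b x → ((b ℕ.+ toℕ ((a ℕ.+ x) mod m)) mod m) ≡ ((a ℕ.+ b ℕ.+ x) mod m)
    mod-lemma a b x = toℕ-injective (begin
        toℕ ((b ℕ.+ toℕ ((a ℕ.+ x) mod m)) mod m)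
          ≡⟨ toℕ-fromℕ< (Data.Nat.DivMod.m%n<n _ m) ⟩
        (b ℕ.+ toℕ ((a ℕ.+ x) mod m)) % m
          ≡⟨ cong (λ t → (b ℕ.+ t) % m) (toℕ-fromℕ< (Data.Nat.DivMod.m%n<n (a ℕ.+ x) m)) ⟩
        (b ℕ.+ (a ℕ.+ x) % m) % m
          ≡⟨ %-distribˡ-+ b ((a ℕ.+ x) % m) m ⟩
        (b % m ℕ.+ (a ℕ.+ x) % m % m) % m
          ≡⟨ cong (λ t → (b % m ℕ.+ t) % m) (m%n%n≡m%n (a ℕ.+ x) m) ⟩
        (b % m ℕ.+ (a ℕ.+ x) % m) % m
          ≡⟨ sym (%-distribˡ-+ b (a ℕ.+ x) m) ⟩
        (b ℕ.+ (a ℕ.+ x)) % m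
          ≡⟨ cong (_% m) (solve b a x) ⟩
        (a ℕ.+ b ℕ.+ x) % m
          ≡⟨ sym (toℕ-fromℕ< (Data.Nat.DivMod.m%n<n _ m)) ⟩
        toℕ ((a ℕ.+ b ℕ.+ x) mod m) ∎)
      where
        open ≡-Reasoning
        solve : ∀ b a x → b ℕ.+ (a ℕ.+ x) ≡ a ℕ.+ b ℕ.+ x
        solve b a x = trans (sym (ℕP.+-assoc b a x)) (cong (ℕ._+ x) (ℕP.+-comm b a))

    diff-lemma : ∀ i j k → (i - j) ℤ.+ (j - k) ≡ i - k
    diff-lemma i j k = begin
        (i - j) ℤ.+ (j - k)        ≡⟨ ℤP.+-assoc i (ℤ.- j) (j - k) ⟩
        i ℤ.+ (ℤ.- j ℤ.+ (j - k))   ≡⟨ cong (λ t → i ℤ.+ t) (sym (ℤP.+-assoc (ℤ.- j) j (ℤ.- k))) ⟩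
        i ℤ.+ ((ℤ.- j ℤ.+ j) - k)   ≡⟨ cong (λ t → i ℤ.+ (t - k)) (ℤP.+-inverseˡ j) ⟩
        i ℤ.+ (0ℤ - k)              ≡⟨ cong (λ t → i ℤ.+ t) (ℤP.+-identityˡ (ℤ.- k)) ⟩
        i - k ∎
      where open ≡-Reasoning

  _∘_ : ∀ {X Y Z} → Hom Y Z → Hom X Y → Hom X Z
  _∘_ {X} {Y} {Z} (hom b pb qb) (hom a pa qa) = hom (a ℕ.+ b) bnd rq
    where
      bnd : + (a ℕ.+ b) ≤ lvl X - lvl Z
      bnd = subst₂ _≤_ (sym (ℤP.pos-+ a b)) (diff-lemma (lvl X) (lvl Y) (lvl Z))
                   (ℤP.+-mono-≤ pa pb)
      rq : (a ℕ.+ b ℕ.+ toℕ (res X)) mod m ≡ res Z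
      rq = trans (sym (mod-lemma a b (toℕ (res X))))
                 (trans (cong (λ y → (b ℕ.+ toℕ y) mod m) qa) qb)

  IntervalObj : ∀ {X Y} → Hom X Y → Set
  IntervalObj {X} {Y} f =
    Σ Obj λ Z → Σ (Hom X Z) λ v → Σ (Hom Z Y) λ u → u ∘ v ≡ f

module Submission where

-- A factorization f = u ∘ v of f : (x̄,i) → (ȳ,j) through a middle object
-- (z̄,k) is determined by two natural numbers: the amount a of v and |k|.
-- Indeed the amount of u is forced to be (amount of f) ∸ a, the residue z̄
-- is forced to be ā + x̄, and every remaining component is a proof of an
-- inequality or of an equation in a type with decidable equality, hence
-- unique.  Moreover a ≤ amount of f and j ≤ k ≤ 0, so the pair (a, |k|)
-- ranges over a finite box Fin (1 + amount f) × Fin (1 + |j|).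

open import Defs
open import Data.Nat as ℕ using (ℕ; NonZero; _<_; _∸_; s≤s)
import Data.Nat.Properties as ℕP
open import Data.Nat.DivMod using (_mod_; m<n⇒m%n≡m)
open import Data.Fin using (Fin; toℕ; fromℕ<)
open import Data.Fin.Properties using (toℕ-fromℕ<; toℕ-injective; toℕ<n; *↔×; _≟_)
open import Data.Integer as ℤ using (ℤ; +_; -[1+_]; _-_; 0ℤ; ∣_∣; +≤+; -≤-)
import Data.Integer.Properties as ℤP
open import Data.Maybe using (Maybe; just; fromMaybe; map)
open import Data.Product using (_×_; _,_; ∃)
open import Function.Bundles using (mk↠ₛ; Surjection)
open import Function.Properties.Inverse using (↔⇒↠)
open import Relation.Nullary.Decidable using (Dec; _×-dec_; dec⇒maybe; dec-yes)
open import Relation.Binary.PropositionalEquality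
open import Axiom.UniquenessOfIdentityProofs.WithK using (uip)

finite-cover : {A B : Set} → A → (decode : B → Maybe A) →
  (∀ a → ∃ λ b → decode b ≡ just a) → Finite B → Finite A
finite-cover default decode reaches (n , enum) =
  n , mk↠ₛ {to = λ i → fromMaybe default (decode (Surjection.to enum i))} hit
  where
    hit : ∀ a → ∃ λ i → fromMaybe default (decode (Surjection.to enum i)) ≡ a
    hit a with reaches a
    ... | b , decode-b with Surjection.strictlySurjective enum b
    ...   | i , refl = i , cong (fromMaybe default) decode-b

neg-abs : ∀ {k} → k ℤ.≤ 0ℤ → ℤ.- (+ ∣ k ∣) ≡ k
neg-abs {+ 0} _ = refl
neg-abs { -[1+ n ]} _ = refl
neg-abs {+ ℕ.suc n} (+≤+ ())

abs-antitone : ∀ {j k} → j ℤ.≤ k → k ℤ.≤ 0ℤ → ∣ k ∣ ℕ.≤ ∣ j ∣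
abs-antitone {k = + 0} _ _ = ℕ.z≤n
abs-antitone {k = -[1+ n ]} (-≤- n≤m) _ = s≤s n≤m
abs-antitone {k = + ℕ.suc n} _ (+≤+ ())

module _ (m : ℕ) .{{_ : NonZero m}} where

  obj-ext : ∀ {Z Z' : Obj m} → res Z ≡ res Z' → lvl Z ≡ lvl Z' → Z ≡ Z'
  obj-ext {obj z k p} {obj .z .k p'} refl refl = cong (obj z k) (ℤP.≤-irrelevant p p')

  hom-ext : ∀ {X Y} {g h : Hom m X Y} → amt g ≡ amt h → g ≡ h
  hom-ext {g = hom a p q} {hom .a p' q'} refl =
    cong₂ (hom a) (ℤP.≤-irrelevant p p') (uip q q')

  factorization-ext : ∀ {X Y} {f : Hom m X Y} {φ ψ : IntervalObj m f} →
    let (Z , v , u , _) = φ ; (Z' , v' , u' , _) = ψ in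
    res Z ≡ res Z' → lvl Z ≡ lvl Z' → amt v ≡ amt v' → amt u ≡ amt u' → φ ≡ ψ
  factorization-ext {φ = Z , v , u , e} {Z' , v' , u' , e'} same-res same-lvl same-v same-u
    with obj-ext {Z} {Z'} same-res same-lvl
  ... | refl with hom-ext {g = v} {v'} same-v | hom-ext {g = u} {u'} same-u
  ...   | refl | refl = cong (λ e → Z , v , u , e) (uip e e')

  level-descends : ∀ {Z Y} → Hom m Z Y → lvl Y ℤ.≤ lvl Z
  level-descends (hom _ bound _) = ℤP.0≤i-j⇒j≤i (ℤP.≤-trans (+≤+ ℕ.z≤n) bound)

  trivial-factorization : ∀ {X Y} (f : Hom m X Y) → IntervalObj m f
  trivial-factorization {X} f = X , identity , f , hom-ext refl
    where
      identity : Hom m X X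
      identity = hom 0 (ℤP.≤-reflexive (sym (ℤP.+-inverseʳ (lvl X))))
        (toℕ-injective (trans (toℕ-fromℕ< _)
          (m<n⇒m%n≡m (toℕ<n (res X)))))

  module _ {X Y : Obj m} (f : Hom m X Y) where

    middle-res : ℕ → Fin m
    middle-res a = (a ℕ.+ toℕ (res X)) mod m

    -- All are decidable, so
    -- the residue and amount equations are simply tested, not derived.
    Admissible : ℕ → ℤ → Set
    Admissible a k =
      (k ℤ.≤ 0ℤ) × (+ a ℤ.≤ lvl X - k) × (+ (amt f ∸ a) ℤ.≤ k - lvl Y) ×
      ((amt f ∸ a ℕ.+ toℕ (middle-res a)) mod m ≡ res Y) × (a ℕ.+ (amt f ∸ a) ≡ amt f)

    admissible? : ∀ a k → Dec (Admissible a k)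
    admissible? a k =
      (k ℤP.≤? 0ℤ) ×-dec (+ a ℤP.≤? lvl X - k) ×-dec (+ (amt f ∸ a) ℤP.≤? k - lvl Y) ×-dec
      (_ ≟ res Y) ×-dec (_ ℕP.≟ amt f)

    build : ∀ {a k} → Admissible a k → IntervalObj m f
    build {a} {k} (k≤0 , v-bound , u-bound , u-res , amounts) =
      obj (middle-res a) k k≤0 , hom a v-bound refl , hom (amt f ∸ a) u-bound u-res ,
      hom-ext amounts

    admissible : ((Z , v , u , _) : IntervalObj m f) → Admissible (amt v) (lvl Z)
    admissible (obj z k k≤0 , hom a v-bound refl , hom b u-bound u-res , refl)
      rewrite ℕP.m+n∸m≡n a b = k≤0 , v-bound , u-bound , u-res , refl

    decode : Fin (ℕ.suc (amt f)) × Fin (ℕ.suc ∣ lvl Y ∣) → Maybe (IntervalObj m f)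
    decode (α , σ) = map build (dec⇒maybe (admissible? (toℕ α) (ℤ.- (+ toℕ σ))))

    decode-reaches : ∀ φ → ∃ λ c → decode c ≡ just φ
    decode-reaches φ@(Z , v , u , e) = (fromℕ< a< , fromℕ< s<) , decodes
      where
        a< : amt v < ℕ.suc (amt f)
        a< = s≤s (subst (amt v ℕ.≤_) (cong amt e) (ℕP.m≤m+n (amt v) (amt u)))
        s< : ∣ lvl Z ∣ < ℕ.suc ∣ lvl Y ∣
        s< = s≤s (abs-antitone (level-descends u) (lvl≤0 Z))
        level : ℤ.- (+ ∣ lvl Z ∣) ≡ lvl Z
        level = neg-abs (lvl≤0 Z)
        decodes : decode (fromℕ< a< , fromℕ< s<) ≡ just φ
        decodes rewrite toℕ-fromℕ< a< | toℕ-fromℕ< s< | level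
          with dec-yes (admissible? (amt v) (lvl Z)) (admissible φ)
        ... | _ , yes-w rewrite yes-w =
          cong just (factorization-ext (resEq v) refl refl u-amount)
          where
            u-amount : amt f ∸ amt v ≡ amt u
            u-amount = trans (cong (_∸ amt v) (sym (cong amt e))) (ℕP.m+n∸m≡n (amt v) (amt u))

-- Proposition 3.1: I(f) is finite, being covered by the decoding of the box
-- Fin (1 + amount f) × Fin (1 + |j|).  (The argument works for every m ≥ 1.)
proposition3p1 : (m : ℕ) .{{_ : NonZero m}} → 1 < m →
    {X Y : Obj m} (f : Hom m X Y) → Finite (IntervalObj m f)
proposition3p1 m _ f =
  finite-cover (trivial-factorization m f) (decode m f) (decode-reaches m f)
    (_ , ↔⇒↠ *↔×)
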